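{- A formal power series $f\in\mathbb{Q}^\theta\langle\langle x\rangle\rangle$ of bounded degree belongs to $\operatorname{sNCQSym}$ if and only if $\sigma\cdot f=f$ for all $\sigma\in\mathfrak{S}_\infty$, where $\cdot$ is the quasisymmetrizing action in noncommuting variables.
   Context: $\mathbb{Q}^\theta\langle\langle x\rangle\rangle$: bounded-degree formal power series over $\mathbb{Q}$ in noncommuting $x_1,x_2,\ldots$ and $\theta_1,\theta_2,\ldots$ with $x_i\theta_j=\theta_jx_i$, $\theta_i\theta_j=-\theta_j\theta_i$; monomials in normal form $\theta_{i_1}\cdots\theta_{i_m}x_{j_1}\cdots x_{j_n}$, $i_1<\cdots<i_m$. For such $u$, $\operatorname{ind}(u)=\{i_1,\ldots,i_m,j_1,\ldots,j_n\}$ and $\operatorname{std}(u)$ is obtained by relabeling indices through the order-preserving bijection $\operatorname{ind}(u)\to[|\operatorname{ind}(u)|]$. $\operatorname{sNCQSym}$ is the set of $f$ in which any two monic monomials with the same standardization have the same coefficient. Action: to a monic monomial $u=\theta_{i_1}\cdots\theta_{i_m}x_{j_1}\cdots x_{j_n}$ associate the infinite sequence $(I_1,I_2,\ldots)$ of subsets with $I_r=\{t\in[n]: j_t=r\}\cup(\{0\}$ if $r\in\{i_1,\ldots,i_m\})$ (a bijection onto such sequences arising from monomials). The simple transposition $s_i$ exchanges $I_i$ and $I_{i+1}$ if at least one of them is empty, and acts trivially otherwise; this defines an action of $\mathfrak{S}_\infty$ on monic monomials, extended linearly to $\mathbb{Q}^\theta\langle\langle x\rangle\rangle$. -}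

module Defs where

open import Data.Nat using (ℕ; zero; suc; _<_; _≟_; _+_; s≤s; z≤n)
open import Data.Nat.Properties using (<-trans; n<1+n; ≤∧≢⇒<; m<n⇒m≤1+n; <-irrefl)
open import Data.List using (List; []; _∷_; _++_; map; length; filter; upTo)
open import Data.List.Relation.Unary.Linked using (Linked; []; [-]; _∷_)
open import Data.List.Relation.Unary.Any using (here; there)
open import Data.List.Membership.Propositional using (_∈_)
open import Data.List.Membership.Propositional.Properties using (∈-++⁺ˡ)
open import Data.List.Membership.DecPropositional _≟_ using (_∈?_)
open import Data.Rational using (ℚ; 0ℚ)
open import Data.Product using (_×_; _,_; ∃-syntax)
open import Relation.Nullary using (¬_; yes; no)
open import Relation.Binary.PropositionalEquality using (_≡_; refl; _≢_; sym)
import Data.Empty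
import Data.Sum
import Data.Nat

-- Convention: the Agda index n ∈ ℕ stands for the paper's index n+1,
-- i.e. θ_n / x_n in Agda are θ_{n+1} / x_{n+1} in the paper, and the
-- Agda generator s n is the paper's simple transposition s_{n+1}.

-- A monic monomial in normal form θ_{i_1}⋯θ_{i_m} x_{j_1}⋯x_{j_n}
-- with i_1 < ⋯ < i_m.
record Monomial : Set where
  constructor mono
  field
    θs       : List ℕ
    θs-strict : Linked _<_ θs
    xs       : List ℕ
open Monomial public

degree : Monomial → ℕ
degree u = length (θs u) + length (xs u)

-- ind(u) (as a list, possibly with repetitions)
ind : Monomial → List ℕ
ind u = θs u ++ xs u

Series : Set
Series = Monomial → ℚ

BoundedDegree : Series → Set
BoundedDegree f = ∃[ d ] (∀ u → d < degree u → f u ≡ 0ℚ)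

-- Standardization: relabel through the order-preserving bijection
-- ind(u) → [|ind(u)|]; j ↦ #{ i ∈ ind(u) | i < j } (0-based, per convention).

rank : List ℕ → ℕ → ℕ
rank L j = length (filter (λ i → i ∈? L) (upTo j))

std : Monomial → List ℕ × List ℕ
std u = map (rank (ind u)) (θs u) , map (rank (ind u)) (xs u)

sNCQSym : Series → Set
sNCQSym f = ∀ u v → std u ≡ std v → f u ≡ f v

-- The action of s_i.  I_i is empty iff i ∉ ind(u).  Exchanging I_i and
-- I_{i+1} amounts to exchanging the labels i and i+1 in u.

swapIdx : ℕ → ℕ → ℕ
swapIdx i j with j ≟ i
... | yes _ = suc i
... | no _ with j ≟ suc i
...   | yes _ = i
...   | no _ = j

private
  swap-< : ∀ i {a b} → a < b → ¬ (a ≡ i × b ≡ suc i) → swapIdx i a < swapIdx i b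
  swap-< i {a} {b} a<b h with a ≟ i | b ≟ i
  ... | yes refl | yes refl = ⊥-elim' (<-irrefl refl a<b)
    where ⊥-elim' : ∀ {A : Set} → Data.Empty.⊥ → A
          ⊥-elim' ()
  ... | yes refl | no b≢i with b ≟ suc i
  ...   | yes refl = ⊥-elim'' (h (refl , refl))
    where ⊥-elim'' : ∀ {A : Set} → Data.Empty.⊥ → A
          ⊥-elim'' ()
  ...   | no b≢si = ≤∧≢⇒< a<b (λ e → b≢si (sym e))
  swap-< i {a} {b} a<b h | no a≢i | yes refl with a ≟ suc i
  ... | yes refl = ⊥-elim''' (<-irrefl refl (<-trans a<b (n<1+n _)))
    where ⊥-elim''' : ∀ {A : Set} → Data.Empty.⊥ → A
          ⊥-elim''' ()
  ... | no _ = <-trans a<b (n<1+n _)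
  swap-< i {a} {b} a<b h | no a≢i | no b≢i with a ≟ suc i | b ≟ suc i
  ... | yes refl | yes refl = ⊥-e (<-irrefl refl a<b)
    where ⊥-e : ∀ {A : Set} → Data.Empty.⊥ → A
          ⊥-e ()
  ... | yes refl | no b≢si = <-trans (n<1+n _) a<b
  ... | no a≢si | yes refl = ≤∧≢⇒< (m<n⇒m≤1+n' a<b) a≢i
    where m<n⇒m≤1+n' : ∀ {m n} → m < suc n → m Data.Nat.≤ n
          m<n⇒m≤1+n' (s≤s p) = p
  ... | no _ | no _ = a<b

  swap-linked : ∀ i L → (¬ (i ∈ L) Data.Sum.⊎ ¬ (suc i ∈ L)) →
                Linked _<_ L → Linked _<_ (map (swapIdx i) L)
  swap-linked i [] h [] = []
  swap-linked i (a ∷ []) h [-] = [-]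
  swap-linked i (a ∷ b ∷ L) h (a<b ∷ r) =
    swap-< i a<b bad ∷ swap-linked i (b ∷ L) (tl h) r
    where
      bad : ¬ (a ≡ i × b ≡ suc i)
      bad (refl , refl) = Data.Sum.[ (λ k → k (here refl)) , (λ k → k (there (here refl))) ] h
      tl : (¬ (i ∈ a ∷ b ∷ L) Data.Sum.⊎ ¬ (suc i ∈ a ∷ b ∷ L)) →
           (¬ (i ∈ b ∷ L) Data.Sum.⊎ ¬ (suc i ∈ b ∷ L))
      tl (Data.Sum.inj₁ k) = Data.Sum.inj₁ (λ m → k (there m))
      tl (Data.Sum.inj₂ k) = Data.Sum.inj₂ (λ m → k (there m))

act : ℕ → Monomial → Monomial
act i u with i ∈? ind u | suc i ∈? ind u
... | yes _ | yes _ = u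
... | no i∉ | _ = mono (map (swapIdx i) (θs u))
                       (swap-linked i (θs u) (Data.Sum.inj₁ (λ m → i∉ (∈-++⁺ˡ m))) (θs-strict u))
                       (map (swapIdx i) (xs u))
... | yes _ | no si∉ = mono (map (swapIdx i) (θs u))
                       (swap-linked i (θs u) (Data.Sum.inj₂ (λ m → si∉ (∈-++⁺ˡ m))) (θs-strict u))
                       (map (swapIdx i) (xs u))

-- An element σ ∈ 𝔖_∞ given as a word s_{a_1} s_{a_2} ⋯ s_{a_k} (list a_1 … a_k).
-- Linear extension to series: since each s_i is an involution on monic
-- monomials, the coefficient of u in s_i · f is f(s_i u).
-- (s_{a_1} ⋯ s_{a_k}) · f = s_{a_1} · ((s_{a_2} ⋯ s_{a_k}) · f).
actSeries : List ℕ → Series → Series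
actSeries [] f u = f u
actSeries (i ∷ w) f u = actSeries w f (act i u)

-- When s_i acts nontrivially it only exchanges the labels i and i+1 inside ind(u), and one of
-- them is absent, so the relabelling is order preserving on ind(u) and std(s_i · u) = std(u).
-- Conversely, while ind(u) has a gap (i+1 ∈ ind(u), i ∉ ind(u)), the move s_i lowers the sum
-- of the indices; when no gap is left, ind(u) is an initial segment and u is its own
-- standardization. Hence two monomials with the same standardization lie in one orbit, and
-- invariance of the coefficients under the action is the same as depending only on std.
module Submission where

open import Defs
open import Data.Empty using (⊥-elim)
open import Data.List using (List; []; _∷_; _++_; [_]; map; length; filter; upTo)
open import Data.List.Properties using (map-++; map-∘; map-cong-local; map-id-local; length-++; filter-++; upTo-∷ʳ)
open import Data.List.Relation.Unary.All using (tabulate)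
open import Data.List.Relation.Unary.Any using (here; there; any?)
import Data.List.Relation.Unary.Linked as Linked
open import Data.List.Membership.Propositional using (_∈_; _∉_; find; lose)
open import Data.List.Membership.Propositional.Properties using (∈-++⁺ˡ; ∈-++⁺ʳ; ∈-map⁺; ∈-map⁻)
open import Data.List.Relation.Binary.Subset.Propositional using (_⊆_)
open import Data.Nat using (ℕ; zero; suc; _≟_; _≤_; _<_; _+_)
open import Data.List.Membership.DecPropositional _≟_ using (_∈?_)
open import Data.Nat.Induction using (<-wellFounded)
open import Data.Nat.ListAction using (sum)
open import Data.Nat.Properties
open import Data.Product using (_×_; _,_; ∃-syntax)
open import Data.Sum using (_⊎_; inj₁; inj₂)
open import Function.Bundles using (_⇔_; mk⇔; Equivalence)
open import Induction.WellFounded using (Acc; acc)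
open import Relation.Nullary using (Dec; yes; no)
open import Relation.Nullary.Decidable using (decidable-stable)
open import Relation.Binary.PropositionalEquality using (_≡_; _≢_; refl; sym; trans; cong; cong₂; subst; module ≡-Reasoning)

swapIdx-i : ∀ i → swapIdx i i ≡ suc i
swapIdx-i i with i ≟ i
... | yes _ = refl
... | no i≢i = ⊥-elim (i≢i refl)

swapIdx-suc : ∀ i → swapIdx i (suc i) ≡ i
swapIdx-suc i with suc i ≟ i
... | yes 1+i≡i = ⊥-elim (1+n≢n 1+i≡i)
... | no _ with suc i ≟ suc i
...   | yes _ = refl
...   | no 1+i≢1+i = ⊥-elim (1+i≢1+i refl)

swapIdx-other : ∀ i {j} → j ≢ i → j ≢ suc i → swapIdx i j ≡ j
swapIdx-other i {j} j≢i j≢1+i with j ≟ i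
... | yes j≡i = ⊥-elim (j≢i j≡i)
... | no _ with j ≟ suc i
...   | yes j≡1+i = ⊥-elim (j≢1+i j≡1+i)
...   | no _ = refl

swapIdx-involutive : ∀ i j → swapIdx i (swapIdx i j) ≡ j
swapIdx-involutive i j with j ≟ i
... | yes refl = swapIdx-suc i
... | no j≢i with j ≟ suc i
...   | yes refl = swapIdx-i i
...   | no j≢1+i = swapIdx-other i j≢i j≢1+i

swapIdx-≤ : ∀ i {a} → a ≢ i → swapIdx i a ≤ a
swapIdx-≤ i {a} a≢i with a ≟ suc i
... | yes refl = ≤-trans (≤-reflexive (swapIdx-suc i)) (n≤1+n i)
... | no a≢1+i = ≤-reflexive (swapIdx-other i a≢i a≢1+i)

map-involutive : ∀ {A : Set} {f : A → A} → (∀ x → f (f x) ≡ x) → ∀ xs → map f (map f xs) ≡ xs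
map-involutive {f = f} f²≡id xs = trans (sym (map-∘ xs)) (map-id-local (tabulate λ {x} _ → f²≡id x))

∈-map-involutive : ∀ {A : Set} {f : A → A} → (∀ x → f (f x) ≡ x) →
                   ∀ {x xs} → x ∈ map f xs ⇔ f x ∈ xs
∈-map-involutive {f = f} f²≡id {x} {xs} = mk⇔ to from
  where
  to : x ∈ map f xs → f x ∈ xs
  to x∈ with ∈-map⁻ f x∈
  ... | y , y∈ , refl = subst (_∈ xs) (sym (f²≡id y)) y∈
  from : f x ∈ xs → x ∈ map f xs
  from fx∈ = subst (_∈ map f xs) (f²≡id x) (∈-map⁺ f fx∈)

indicator : List ℕ → ℕ → ℕ
indicator L k with k ∈? L
... | yes _ = 1
... | no _ = 0

indicator-∈ : ∀ {L k} → k ∈ L → indicator L k ≡ 1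
indicator-∈ {L} {k} k∈ with k ∈? L
... | yes _ = refl
... | no k∉ = ⊥-elim (k∉ k∈)

indicator-∉ : ∀ {L k} → k ∉ L → indicator L k ≡ 0
indicator-∉ {L} {k} k∉ with k ∈? L
... | yes k∈ = ⊥-elim (k∉ k∈)
... | no _ = refl

indicator-cong : ∀ {A B k m} → k ∈ A ⇔ m ∈ B → indicator A k ≡ indicator B m
indicator-cong {A} {B} {k} {m} k⇔m with k ∈? A | m ∈? B
... | yes _ | yes _ = refl
... | no _ | no _ = refl
... | yes k∈ | no m∉ = ⊥-elim (m∉ (Equivalence.to k⇔m k∈))
... | no k∉ | yes m∈ = ⊥-elim (k∉ (Equivalence.from k⇔m m∈))

indicator-map-swapIdx : ∀ i L k → indicator (map (swapIdx i) L) k ≡ indicator L (swapIdx i k)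
indicator-map-swapIdx i L k = indicator-cong (∈-map-involutive (swapIdx-involutive i))

rank-suc : ∀ L j → rank L (suc j) ≡ rank L j + indicator L j
rank-suc L j = begin
  length (filter (_∈? L) (upTo (suc j)))                     ≡⟨ cong (λ xs → length (filter (_∈? L) xs)) (sym (upTo-∷ʳ j)) ⟩
  length (filter (_∈? L) (upTo j ++ [ j ]))                  ≡⟨ cong length (filter-++ (_∈? L) (upTo j) [ j ]) ⟩
  length (filter (_∈? L) (upTo j) ++ filter (_∈? L) [ j ])   ≡⟨ length-++ (filter (_∈? L) (upTo j)) ⟩
  rank L j + length (filter (_∈? L) [ j ])                   ≡⟨ cong (rank L j +_) singleton ⟩
  rank L j + indicator L j                                   ∎
  where
  open ≡-Reasoning
  singleton : length (filter (_∈? L) [ j ]) ≡ indicator L j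
  singleton with j ∈? L
  ... | yes _ = refl
  ... | no _ = refl

rank-suc-∉ : ∀ {L j} → j ∉ L → rank L (suc j) ≡ rank L j
rank-suc-∉ {L} {j} j∉ = trans (rank-suc L j) (trans (cong (rank L j +_) (indicator-∉ j∉)) (+-identityʳ _))

rank-initial : ∀ L j → (∀ {k} → k < j → k ∈ L) → rank L j ≡ j
rank-initial L zero _ = refl
rank-initial L (suc j) below = begin
  rank L (suc j)            ≡⟨ rank-suc L j ⟩
  rank L j + indicator L j  ≡⟨ cong₂ _+_ (rank-initial L j (λ k<j → below (m<n⇒m<1+n k<j))) (indicator-∈ (below ≤-refl)) ⟩
  j + 1                     ≡⟨ +-comm j 1 ⟩
  suc j                     ∎
  where open ≡-Reasoning

module _ (i : ℕ) {L : List ℕ} (i∉L : i ∉ L) where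
  private
    L′ : List ℕ
    L′ = map (swapIdx i) L

  rank-map-swapIdx : ∀ j → j ≢ suc i → rank L′ j ≡ rank L j
  rank-map-swapIdx zero _ = refl
  rank-map-swapIdx (suc j) 1+j≢1+i with j ≟ suc i
  ... | yes refl = begin
    rank L′ (suc (suc i))                                      ≡⟨ rank-suc L′ (suc i) ⟩
    rank L′ (suc i) + indicator L′ (suc i)                     ≡⟨ cong (_+ indicator L′ (suc i)) (rank-suc L′ i) ⟩
    rank L′ i + indicator L′ i + indicator L′ (suc i)          ≡⟨ cong₂ (λ r s → r + s) (cong₂ _+_ (rank-map-swapIdx i i≢1+i) swap-at-i) swap-at-1+i ⟩
    rank L i + indicator L (suc i) + indicator L i             ≡⟨ cong (rank L i + indicator L (suc i) +_) (indicator-∉ i∉L) ⟩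
    rank L i + indicator L (suc i) + 0                         ≡⟨ +-identityʳ _ ⟩
    rank L i + indicator L (suc i)                             ≡⟨ cong (_+ indicator L (suc i)) (sym (rank-suc-∉ i∉L)) ⟩
    rank L (suc i) + indicator L (suc i)                       ≡⟨ sym (rank-suc L (suc i)) ⟩
    rank L (suc (suc i))                                       ∎
    where
    open ≡-Reasoning
    i≢1+i : i ≢ suc i
    i≢1+i = <⇒≢ (n<1+n i)
    swap-at-i : indicator L′ i ≡ indicator L (suc i)
    swap-at-i = trans (indicator-map-swapIdx i L i) (cong (indicator L) (swapIdx-i i))
    swap-at-1+i : indicator L′ (suc i) ≡ indicator L i
    swap-at-1+i = trans (indicator-map-swapIdx i L (suc i)) (cong (indicator L) (swapIdx-suc i))
  ... | no j≢1+i = begin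
    rank L′ (suc j)                          ≡⟨ rank-suc L′ j ⟩
    rank L′ j + indicator L′ j               ≡⟨ cong₂ _+_ (rank-map-swapIdx j j≢1+i) (indicator-map-swapIdx i L j) ⟩
    rank L j + indicator L (swapIdx i j)     ≡⟨ cong (λ k → rank L j + indicator L k) (swapIdx-other i j≢i j≢1+i) ⟩
    rank L j + indicator L j                 ≡⟨ sym (rank-suc L j) ⟩
    rank L (suc j)                           ∎
    where
    open ≡-Reasoning
    j≢i : j ≢ i
    j≢i j≡i = 1+j≢1+i (cong suc j≡i)

  rank-map-swapIdx-∈ : ∀ {a} → a ∈ L → rank L′ (swapIdx i a) ≡ rank L a
  rank-map-swapIdx-∈ {a} a∈ with a ≟ suc i
  ... | yes refl = begin
    rank L′ (swapIdx i (suc i))  ≡⟨ cong (rank L′) (swapIdx-suc i) ⟩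
    rank L′ i                    ≡⟨ rank-map-swapIdx i (<⇒≢ (n<1+n i)) ⟩
    rank L i                     ≡⟨ sym (rank-suc-∉ i∉L) ⟩
    rank L (suc i)               ∎
    where open ≡-Reasoning
  ... | no a≢1+i = trans (cong (rank L′) (swapIdx-other i a≢i a≢1+i)) (rank-map-swapIdx a a≢1+i)
    where
    a≢i : a ≢ i
    a≢i refl = i∉L a∈

-- The case i+1 ∉ L reduces to the case i ∉ L, applied to the relabelled list.
rank-map-swapIdx-∈′ : ∀ i {L a} → i ∉ L ⊎ suc i ∉ L → a ∈ L → rank (map (swapIdx i) L) (swapIdx i a) ≡ rank L a
rank-map-swapIdx-∈′ i (inj₁ i∉L) a∈ = rank-map-swapIdx-∈ i i∉L a∈
rank-map-swapIdx-∈′ i {L} {a} (inj₂ 1+i∉L) a∈ = sym (begin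
  rank L a                            ≡⟨ cong₂ rank (sym (map-involutive (swapIdx-involutive i) L)) (sym (swapIdx-involutive i a)) ⟩
  rank (map s K) (s (s a))            ≡⟨ rank-map-swapIdx-∈ i i∉K (∈-map⁺ s a∈) ⟩
  rank K (s a)                        ∎)
  where
  open ≡-Reasoning
  s : ℕ → ℕ
  s = swapIdx i
  K : List ℕ
  K = map s L
  i∉K : i ∉ K
  i∉K i∈K = 1+i∉L (subst (_∈ L) (swapIdx-i i) (Equivalence.to (∈-map-involutive (swapIdx-involutive i)) i∈K))

map-rank-swapIdx : ∀ i {L M} → i ∉ L ⊎ suc i ∉ L → M ⊆ L →
                   map (rank (map (swapIdx i) L)) (map (swapIdx i) M) ≡ map (rank L) M
map-rank-swapIdx i {M = M} gap M⊆L =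
  trans (sym (map-∘ M)) (map-cong-local (tabulate λ a∈ → rank-map-swapIdx-∈′ i gap (M⊆L a∈)))

std-swapIdx : ∀ i u v → i ∉ ind u ⊎ suc i ∉ ind u →
              θs v ≡ map (swapIdx i) (θs u) → xs v ≡ map (swapIdx i) (xs u) → std v ≡ std u
std-swapIdx i u (mono _ _ _) gap refl refl = cong₂ _,_ (relabel ∈-++⁺ˡ) (relabel (∈-++⁺ʳ (θs u)))
  where
  s : ℕ → ℕ
  s = swapIdx i
  relabel : ∀ {M} → M ⊆ ind u → map (rank (map s (θs u) ++ map s (xs u))) (map s M) ≡ map (rank (ind u)) M
  relabel {M} M⊆ = trans (cong (λ K → map (rank K) (map s M)) (sym (map-++ s (θs u) (xs u))))
                         (map-rank-swapIdx i gap M⊆)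

act-cases : ∀ i u → act i u ≡ u ⊎ ((i ∉ ind u ⊎ suc i ∉ ind u) ×
                                      θs (act i u) ≡ map (swapIdx i) (θs u) × xs (act i u) ≡ map (swapIdx i) (xs u))
act-cases i u with i ∈? ind u | suc i ∈? ind u
... | yes _ | yes _ = inj₁ refl
... | no i∉ | _ = inj₂ (inj₁ i∉ , refl , refl)
... | yes _ | no 1+i∉ = inj₂ (inj₂ 1+i∉ , refl , refl)

std-act : ∀ i u → std (act i u) ≡ std u
std-act i u with act-cases i u
... | inj₁ act≡u = cong std act≡u
... | inj₂ (gap , θs≡ , xs≡) = std-swapIdx i u (act i u) gap θs≡ xs≡

ind-act-∉ : ∀ {i} u → i ∉ ind u → ind (act i u) ≡ map (swapIdx i) (ind u)
ind-act-∉ {i} u i∉ with i ∈? ind u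
... | yes i∈ = ⊥-elim (i∉ i∈)
... | no _ = sym (map-++ (swapIdx i) (θs u) (xs u))

actList : List ℕ → Monomial → Monomial
actList [] u = u
actList (i ∷ σ) u = actList σ (act i u)

actSeries-actList : ∀ σ f u → actSeries σ f u ≡ f (actList σ u)
actSeries-actList [] f u = refl
actSeries-actList (i ∷ σ) f u = actSeries-actList σ f (act i u)

std-actList : ∀ σ u → std (actList σ u) ≡ std u
std-actList [] u = refl
std-actList (i ∷ σ) u = trans (std-actList σ (act i u)) (std-act i u)

IsStandard : Monomial → Set
IsStandard u = (θs u , xs u) ≡ std u

standard-unique : ∀ {u v} → IsStandard u → IsStandard v → std u ≡ std v → u ≡ v
standard-unique {mono θ p x} {mono _ q _} u-std v-std std≡ with trans u-std (trans std≡ (sym v-std))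
... | refl = cong (λ r → mono θ r x) (Linked.irrelevant <-irrelevant p q)

DownClosed : List ℕ → Set
DownClosed L = ∀ {j} → suc j ∈ L → j ∈ L

Gap : List ℕ → Set
Gap L = ∃[ i ] (suc i ∈ L × i ∉ L)

gapBelow? : ∀ L a → Dec (∃[ i ] (a ≡ suc i × i ∉ L))
gapBelow? L zero = no λ { (_ , () , _) }
gapBelow? L (suc i) with i ∈? L
... | yes i∈ = no λ { (_ , refl , i∉) → i∉ i∈ }
... | no i∉ = yes (i , refl , i∉)

downClosed⊎gap : ∀ L → DownClosed L ⊎ Gap L
downClosed⊎gap L with any? (gapBelow? L) L
... | no ¬gap = inj₁ λ {j} 1+j∈ → decidable-stable (j ∈? L) (λ j∉ → ¬gap (lose 1+j∈ (j , refl , j∉)))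
... | yes gap with find gap
...   | _ , a∈ , i , refl , i∉ = inj₂ (i , a∈ , i∉)

downClosed-< : ∀ {L} → DownClosed L → ∀ {a k} → a ∈ L → k < a → k ∈ L
downClosed-< closed {suc a} a∈ k<1+a with m<1+n⇒m<n∨m≡n k<1+a
... | inj₁ k<a = downClosed-< closed (closed a∈) k<a
... | inj₂ refl = closed a∈

downClosed⇒standard : ∀ u → DownClosed (ind u) → IsStandard u
downClosed⇒standard u closed = cong₂ _,_ (fixed ∈-++⁺ˡ) (fixed (∈-++⁺ʳ (θs u)))
  where
  fixed : ∀ {M} → M ⊆ ind u → M ≡ map (rank (ind u)) M
  fixed M⊆ = sym (map-id-local (tabulate λ a∈ → rank-initial (ind u) _ (downClosed-< closed (M⊆ a∈))))

sum-map-swapIdx-≤ : ∀ i {L} → i ∉ L → sum (map (swapIdx i) L) ≤ sum L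
sum-map-swapIdx-≤ i {[]} _ = ≤-refl
sum-map-swapIdx-≤ i {a ∷ L} i∉ =
  +-mono-≤ (swapIdx-≤ i λ { refl → i∉ (here refl) }) (sum-map-swapIdx-≤ i (λ i∈ → i∉ (there i∈)))

sum-map-swapIdx-< : ∀ i {L} → i ∉ L → suc i ∈ L → sum (map (swapIdx i) L) < sum L
sum-map-swapIdx-< i {_ ∷ L} i∉ (here refl) =
  +-mono-<-≤ (≤-reflexive (cong suc (swapIdx-suc i))) (sum-map-swapIdx-≤ i (λ i∈ → i∉ (there i∈)))
sum-map-swapIdx-< i {_ ∷ L} i∉ (there 1+i∈) =
  +-mono-≤-< (swapIdx-≤ i λ { refl → i∉ (here refl) }) (sum-map-swapIdx-< i (λ i∈ → i∉ (there i∈)) 1+i∈)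

sum-ind-act-< : ∀ {i} u → i ∉ ind u → suc i ∈ ind u → sum (ind (act i u)) < sum (ind u)
sum-ind-act-< {i} u i∉ 1+i∈ =
  subst (λ K → sum K < sum (ind u)) (sym (ind-act-∉ u i∉)) (sum-map-swapIdx-< i i∉ 1+i∈)

reaches-standard : ∀ u → Acc _<_ (sum (ind u)) → ∃[ σ ] IsStandard (actList σ u)
reaches-standard u (acc smaller⇒acc) with downClosed⊎gap (ind u)
... | inj₁ closed = [] , downClosed⇒standard u closed
... | inj₂ (i , 1+i∈ , i∉) with reaches-standard (act i u) (smaller⇒acc (sum-ind-act-< u i∉ 1+i∈))
...   | σ , standard = i ∷ σ , standard

Invariant : Series → Set
Invariant f = ∀ (σ : List ℕ) (u : Monomial) → actSeries σ f u ≡ f u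

sNCQSym⇒invariant : ∀ f → sNCQSym f → Invariant f
sNCQSym⇒invariant f sym-f σ u = trans (actSeries-actList σ f u) (sym-f _ u (std-actList σ u))

invariant⇒sNCQSym : ∀ f → Invariant f → sNCQSym f
invariant⇒sNCQSym f inv u v std≡ with reaches-standard u (<-wellFounded _) | reaches-standard v (<-wellFounded _)
... | σ , u′-std | τ , v′-std = begin
  f u                ≡⟨ sym (f-actList σ u) ⟩
  f (actList σ u)    ≡⟨ cong f (standard-unique u′-std v′-std std′≡) ⟩
  f (actList τ v)    ≡⟨ f-actList τ v ⟩
  f v                ∎
  where
  open ≡-Reasoning
  f-actList : ∀ ρ w → f (actList ρ w) ≡ f w
  f-actList ρ w = trans (sym (actSeries-actList ρ f w)) (inv ρ w)
  std′≡ : std (actList σ u) ≡ std (actList τ v)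
  std′≡ = trans (std-actList σ u) (trans std≡ (sym (std-actList τ v)))

proposition4p3 : (f : Series) → BoundedDegree f →
    (sNCQSym f ⇔ (∀ (σ : List ℕ) (u : Monomial) → actSeries σ f u ≡ f u))
proposition4p3 f _ = mk⇔ (sNCQSym⇒invariant f) (invariant⇒sNCQSym f)
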